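{- There exists an infinite word $w$ over the alphabet $\{0,1,2\}$ such that $w^{0\cup1}$, $w^{0\cup2}$ and $w^{1\cup2}$ are all weak abelian periodic, while $w$ itself is not weak abelian periodic.
   Context: For a word $w$ over an alphabet $\Sigma$ and distinct letters $a,b\in\Sigma$, $w^{a\cup b}$ denotes the word over $\Sigma\setminus\{b\}$ obtained from $w$ by replacing every occurrence of $b$ by $a$ (the image of $w$ under the morphism $b\mapsto a$, $c\mapsto c$ for $c\ne b$). For a finite nonempty word $u$, $\rho_a(u)=|u|_a/|u|$ where $|u|_a$ is the number of occurrences of $a$ in $u$. An infinite word $w$ over a finite alphabet $\Sigma$ is weak abelian periodic if $w=v_0v_1v_2\cdots$ with finite words $v_i$ ($v_i$ nonempty for $i\ge1$) such that $\rho_a(v_i)=\rho_a(v_j)$ for all $a\in\Sigma$ and all $i,j\ge1$. -}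

module Defs where

open import Data.Nat using (ℕ; zero; suc; _+_; _*_; _∸_; _<_)
open import Data.Fin using (Fin)
open import Data.Fin.Properties using (_≟_)
open import Data.Product using (Σ; ∃; _,_; proj₁)
open import Relation.Binary.PropositionalEquality using (_≡_; _≢_)
open import Relation.Binary.Definitions using (DecidableEquality)
open import Relation.Nullary using (yes; no)

Word : Set → Set
Word A = ℕ → A

count : {A : Set} → DecidableEquality A → Word A → A → ℕ → ℕ → ℕ
count eq w a m zero = 0
count eq w a m (suc len) with eq (w m) a
... | yes _ = suc (count eq w a (suc m) len)
... | no  _ = count eq w a (suc m) len

-- A factorization w = v₀ v₁ v₂ ⋯ with v_i nonempty for i ≥ 1 is given by
-- the cut points c 0 < c 1 < c 2 < ⋯ : v₀ = w[0, c 0) and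
-- v_{i+1} = w[c i, c (suc i)).
-- Length of v_{i+1} and number of a's in v_{i+1}:
blockLen : (ℕ → ℕ) → ℕ → ℕ
blockLen c i = c (suc i) ∸ c i

blockCount : {A : Set} → DecidableEquality A → Word A → (ℕ → ℕ) → A → ℕ → ℕ
blockCount eq w c a i = count eq w a (c i) (blockLen c i)

-- Weak abelian periodicity over the alphabet A:
-- ρ_a(v_i) = ρ_a(v_j), i.e. |v_i|_a / |v_i| = |v_j|_a / |v_j|, written as
-- equality of fractions by cross-multiplication (lengths are nonzero).
WeakAbelianPeriodic : {A : Set} → DecidableEquality A → Word A → Set
WeakAbelianPeriodic {A} eq w =
  Σ (ℕ → ℕ) λ c →
    ((i : ℕ) → c i < c (suc i)) ×′
    ((a : A) → (i j : ℕ) →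
       blockCount eq w c a i * blockLen c j ≡ blockCount eq w c a j * blockLen c i)
  where
  open import Data.Product using () renaming (_×_ to _×′_)

Without : Fin 3 → Set
Without b = Σ (Fin 3) λ c → c ≢ b

decWithout : (b : Fin 3) → DecidableEquality (Without b)
decWithout b (x , p) (y , q) with x ≟ y
... | yes _≡_.refl = yes _≡_.refl   -- proofs of ≢ are functions into ⊥
... | no x≢y = no λ { _≡_.refl → x≢y _≡_.refl }

-- w^{a∪b}: replace every b by a; a word over Σ ∖ {b}.
merge : (a b : Fin 3) → a ≢ b → Word (Fin 3) → Word (Without b)
merge a b a≢b w n with w n ≟ b
... | yes _ = a , a≢b
... | no  c≢b = w n , c≢b

module Submission where

-- The word w is 0 1 2 0 1 2 ⋯ written in runs of factorially growing length:
-- run r occupies the positions [T r, T (r+1)) with T (r+1) = (r+1)!, and carries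
-- the letter r mod 3.  Run r+1 has length (r+1)·T (r+1), so it is longer than
-- everything written before it.
--
-- Merging two letters leaves a binary word over {a, t}.  If N is the number of
-- t's up to the end of a t-run, the cut at 2N falls inside the following (t-free)
-- run, so the prefix of length 2N is exactly half t.  Prefixes of density 1/2
-- give blocks of density 1/2 for both letters: each merged word is periodic.
--
-- The word w is not: in a weak abelian factorization with first block of length
-- L every letter a has density p_a / L in every block, with 1 ≤ p_a ≤ L.  A block
-- ending inside run r+1, r > L, contains a letter of run r+2, hence all of run r:
-- at least r·T r letters x = (r mod 3) against at most T r letters y = (r+2 mod 3),
-- and comparing the densities of x and y forces r ≤ L.

open import Defs
open import Data.Fin using (Fin; zero; suc; toℕ)
open import Data.Fin.Properties using (_≟_; all?)
open import Data.Nat using (ℕ; zero; suc; _+_; _*_; _∸_; _<_; _≤_; _≤′_; ≤′-refl; ≤′-step; z≤n; s≤s; s≤s⁻¹; _<?_; _!; NonZero; >-nonZero)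
  renaming (_≟_ to _≟ℕ_)
open import Data.Nat.Properties hiding (_≟_)
open import Data.Nat.Solver using (module +-*-Solver)
open import Data.Product using (Σ; ∃-syntax; _×_; _,_; proj₁; proj₂)
open import Data.Sum using (_⊎_; inj₁; inj₂)
open import Data.Empty using (⊥; ⊥-elim)
open import Relation.Nullary using (¬_; ¬?; yes; no)
open import Relation.Nullary.Decidable using (_→-dec_; toWitness)
open import Relation.Binary.Definitions using (DecidableEquality)
open import Relation.Binary.PropositionalEquality

open +-*-Solver using (solve; con; _:+_; _:*_; _:=_)

cross : ∀ A B P Q L M .{{_ : NonZero L}} →
        A * L ≡ P * M → B * L ≡ Q * M → A * Q ≡ B * P
cross A B P Q L M AL≡PM BL≡QM = *-cancelʳ-≡ (A * Q) (B * P) L (begin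
  A * Q * L   ≡⟨ swap A Q L ⟩
  A * L * Q   ≡⟨ cong (_* Q) AL≡PM ⟩
  P * M * Q   ≡⟨ solve 3 (λ P M Q → P :* M :* Q := Q :* M :* P) refl P M Q ⟩
  Q * M * P   ≡⟨ cong (_* P) BL≡QM ⟨
  B * L * P   ≡⟨ swap B L P ⟩
  B * P * L   ∎)
  where
  open ≡-Reasoning
  swap : ∀ x y z → x * y * z ≡ x * z * y
  swap = solve 3 (λ x y z → x :* y :* z := x :* z :* y) refl

pos-factor : ∀ A L {P M} → A * L ≡ P * M → 1 ≤ P → 1 ≤ M → 1 ≤ A
pos-factor zero    L {P} {M} 0≡PM 1≤P 1≤M =
  ⊥-elim (<⇒≱ (*-mono-≤ 1≤P 1≤M) (≤-reflexive (sym 0≡PM)))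
pos-factor (suc A) L _ _ _ = s≤s z≤n

module Counting {A : Set} (eq : DecidableEquality A) (u : Word A) (a : A) where

  private
    cnt : ℕ → ℕ → ℕ
    cnt = count eq u a

  count-+ : ∀ m l₁ l₂ → cnt m (l₁ + l₂) ≡ cnt m l₁ + cnt (m + l₁) l₂
  count-+ m zero     l₂ = cong (λ k → cnt k l₂) (sym (+-identityʳ m))
  count-+ m (suc l₁) l₂ with eq (u m) a
  ... | yes _ = cong suc (trans (count-+ (suc m) l₁ l₂) shift)
    where shift = cong (λ k → cnt (suc m) l₁ + cnt k l₂) (sym (+-suc m l₁))
  ... | no  _ = trans (count-+ (suc m) l₁ l₂) shift
    where shift = cong (λ k → cnt (suc m) l₁ + cnt k l₂) (sym (+-suc m l₁))

  count-≤ : ∀ m l → cnt m l ≤ l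
  count-≤ m zero = z≤n
  count-≤ m (suc l) with eq (u m) a
  ... | yes _ = s≤s (count-≤ (suc m) l)
  ... | no  _ = m≤n⇒m≤1+n (count-≤ (suc m) l)

  private
    tail : ∀ {m l k} → suc m ≤ k → k < suc m + l → m ≤ k × k < m + suc l
    tail {m} {l} {k} m<k k<sm+l = <⇒≤ m<k , subst (k <_) (sym (+-suc m l)) k<sm+l

    head : ∀ m l → m ≤ m × m < m + suc l
    head m l = ≤-refl , subst (m <_) (sym (+-suc m l)) (s≤s (m≤m+n m l))

  count-all : ∀ m l → (∀ k → m ≤ k → k < m + l → u k ≡ a) → cnt m l ≡ l
  count-all m zero    _   = refl
  count-all m (suc l) all with eq (u m) a
  ... | yes _   = cong suc (count-all (suc m) l λ k p q → let p′ , q′ = tail p q in all k p′ q′)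
  ... | no  u≢a = ⊥-elim (u≢a (let p , q = head m l in all m p q))

  count-none : ∀ m l → (∀ k → m ≤ k → k < m + l → u k ≢ a) → cnt m l ≡ 0
  count-none m zero    _    = refl
  count-none m (suc l) none with eq (u m) a
  ... | no  _   = count-none (suc m) l λ k p q → let p′ , q′ = tail p q in none k p′ q′
  ... | yes u≡a = ⊥-elim (let p , q = head m l in none m p q u≡a)

  count-at : ∀ m l q → m ≤ q → q < m + l → u q ≡ a → 1 ≤ cnt m l
  count-at m zero    q m≤q q<m+0 _ = ⊥-elim (<⇒≱ q<m+0 (subst (_≤ q) (sym (+-identityʳ m)) m≤q))
  count-at m (suc l) q m≤q q<m+l uq≡a with eq (u m) a
  ... | yes _ = s≤s z≤n
  ... | no  u≢a with m ≟ℕ q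
  ...   | yes refl = ⊥-elim (u≢a uq≡a)
  ...   | no  m≢q  = count-at (suc m) l q (≤∧≢⇒< m≤q m≢q) (subst (q <_) (+-suc m l) q<m+l) uq≡a

  occ : ℕ → ℕ → ℕ
  occ m n = cnt m (n ∸ m)

  occ-split : ∀ {m n k} → m ≤ n → n ≤ k → occ m n + occ n k ≡ occ m k
  occ-split {m} {n} {k} m≤n n≤k = begin
    cnt m (n ∸ m) + cnt n (k ∸ n)               ≡⟨ cong (λ x → cnt m (n ∸ m) + cnt x (k ∸ n)) (m+[n∸m]≡n m≤n) ⟨
    cnt m (n ∸ m) + cnt (m + (n ∸ m)) (k ∸ n)   ≡⟨ count-+ m (n ∸ m) (k ∸ n) ⟨
    cnt m ((n ∸ m) + (k ∸ n))                   ≡⟨ cong (cnt m) lengths ⟩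
    cnt m (k ∸ m)                               ∎
    where
    open ≡-Reasoning
    lengths : (n ∸ m) + (k ∸ n) ≡ k ∸ m
    lengths = begin
      (n ∸ m) + (k ∸ n)     ≡⟨ +-∸-comm (k ∸ n) m≤n ⟨
      (n + (k ∸ n)) ∸ m     ≡⟨ cong (_∸ m) (m+[n∸m]≡n n≤k) ⟩
      k ∸ m                 ∎

  occ-≤ : ∀ m n → occ m n ≤ n ∸ m
  occ-≤ m n = count-≤ m (n ∸ m)

  occ-all : ∀ {m n} → m ≤ n → (∀ k → m ≤ k → k < n → u k ≡ a) → occ m n ≡ n ∸ m
  occ-all {m} {n} m≤n all = count-all m (n ∸ m) λ k p q → all k p (subst (k <_) (m+[n∸m]≡n m≤n) q)

  occ-none : ∀ {m n} → m ≤ n → (∀ k → m ≤ k → k < n → u k ≢ a) → occ m n ≡ 0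
  occ-none {m} {n} m≤n none = count-none m (n ∸ m) λ k p q → none k p (subst (k <_) (m+[n∸m]≡n m≤n) q)

  occ-at : ∀ {m n q} → m ≤ q → q < n → u q ≡ a → 1 ≤ occ m n
  occ-at {m} {n} {q} m≤q q<n =
    count-at m (n ∸ m) q m≤q (subst (q <_) (sym (m+[n∸m]≡n (≤-trans m≤q (<⇒≤ q<n)))) q<n)

  occ-mono : ∀ {m′ m n n′} → m′ ≤ m → m ≤ n → n ≤ n′ → occ m n ≤ occ m′ n′
  occ-mono {m′} {m} {n} {n′} m′≤m m≤n n≤n′ = begin
    occ m n                          ≤⟨ m≤n+m (occ m n) (occ m′ m) ⟩
    occ m′ m + occ m n               ≡⟨ occ-split m′≤m m≤n ⟩
    occ m′ n                         ≤⟨ m≤m+n (occ m′ n) (occ n n′) ⟩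
    occ m′ n + occ n n′              ≡⟨ occ-split (≤-trans m′≤m m≤n) n≤n′ ⟩
    occ m′ n′                        ∎
    where open ≤-Reasoning

  factor-density : ∀ {m n} p q → m ≤ n →
    q * occ 0 m ≡ p * m → q * occ 0 n ≡ p * n → q * occ m n ≡ p * (n ∸ m)
  factor-density {m} {n} p q m≤n prefix-m prefix-n = begin
    q * occ m n                        ≡⟨ cong (q *_) (m+n∸m≡n (occ 0 m) (occ m n)) ⟨
    q * (occ 0 m + occ m n ∸ occ 0 m)  ≡⟨ cong (λ x → q * (x ∸ occ 0 m)) (occ-split z≤n m≤n) ⟩
    q * (occ 0 n ∸ occ 0 m)            ≡⟨ *-distribˡ-∸ q (occ 0 n) (occ 0 m) ⟩
    q * occ 0 n ∸ q * occ 0 m          ≡⟨ cong₂ _∸_ prefix-n prefix-m ⟩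
    p * n ∸ p * m                      ≡⟨ *-distribˡ-∸ p n m ⟨
    p * (n ∸ m)                        ∎
    where open ≡-Reasoning

count-≡ : {A B : Set} (eqA : DecidableEquality A) (eqB : DecidableEquality B)
  (u : Word A) (v : Word B) (x : A) (y : B) →
  (∀ k → u k ≡ x → v k ≡ y) → (∀ k → v k ≡ y → u k ≡ x) →
  ∀ m l → count eqA u x m l ≡ count eqB v y m l
count-≡ eqA eqB u v x y u⇒v v⇒u m zero = refl
count-≡ eqA eqB u v x y u⇒v v⇒u m (suc l) with eqA (u m) x | eqB (v m) y
... | yes _   | yes _   = cong suc (count-≡ eqA eqB u v x y u⇒v v⇒u (suc m) l)
... | no  _   | no  _   = count-≡ eqA eqB u v x y u⇒v v⇒u (suc m) l
... | yes u≡x | no  v≢y = ⊥-elim (v≢y (u⇒v m u≡x))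
... | no  u≢x | yes v≡y = ⊥-elim (u≢x (v⇒u m v≡y))

count-binary : {A : Set} (eq : DecidableEquality A) (u : Word A) (x y : A) → x ≢ y →
  (∀ k → u k ≡ x ⊎ u k ≡ y) → ∀ m l → count eq u x m l + count eq u y m l ≡ l
count-binary eq u x y x≢y binary m zero = refl
count-binary eq u x y x≢y binary m (suc l) with eq (u m) x | eq (u m) y | binary m
... | yes u≡x | yes u≡y | _      = ⊥-elim (x≢y (trans (sym u≡x) u≡y))
... | yes _   | no  _   | _      = cong suc (count-binary eq u x y x≢y binary (suc m) l)
... | no  _   | yes _   | _      = trans (+-suc _ _) (cong suc (count-binary eq u x y x≢y binary (suc m) l))
... | no  u≢x | no  _   | inj₁ u≡x = ⊥-elim (u≢x u≡x)
... | no  _   | no  u≢y | inj₂ u≡y = ⊥-elim (u≢y u≡y)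

module Cuts (c : ℕ → ℕ) (strict : ∀ i → c i < c (suc i)) where

  cut-≥ : ∀ i → i ≤ c i
  cut-≥ zero    = z≤n
  cut-≥ (suc i) = ≤-<-trans (cut-≥ i) (strict i)

  block-below : ∀ n {q} → c 0 ≤ q → q < c n → ∃[ i ] c i ≤ q × q < c (suc i)
  block-below zero    c₀≤q q<c₀ = ⊥-elim (<⇒≱ q<c₀ c₀≤q)
  block-below (suc n) {q} c₀≤q q<cₙ₊₁ with q <? c n
  ... | yes q<cₙ = block-below n c₀≤q q<cₙ
  ... | no  q≮cₙ = n , ≮⇒≥ q≮cₙ , q<cₙ₊₁

  block-of : ∀ q → c 0 ≤ q → ∃[ i ] c i ≤ q × q < c (suc i)
  block-of q c₀≤q = block-below (suc q) c₀≤q (cut-≥ (suc q))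

densities⇒periodic : {A : Set} (eq : DecidableEquality A) (u : Word A) (c : ℕ → ℕ) →
  (∀ i → c i < c (suc i)) → (p : A → ℕ) (q : ℕ) .{{_ : NonZero q}} →
  (∀ a i → q * blockCount eq u c a i ≡ p a * blockLen c i) → WeakAbelianPeriodic eq u
densities⇒periodic eq u c strict p q density = c , strict , λ a i j →
  cross (blockCount eq u c a i) (blockCount eq u c a j) (blockLen c i) (blockLen c j) q (p a)
        (normal a i) (normal a j)
  where
  normal : ∀ a i → blockCount eq u c a i * q ≡ blockLen c i * p a
  normal a i = trans (*-comm _ q) (trans (density a i) (*-comm (p a) _))

-- Run boundaries: run r occupies [T r, T (r+1)), where T (r+1) = (r+1)!.  T is
-- opaque: the development only uses the facts proved in this block, and unfolding
-- factorials of symbolic arguments swamps unification.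
opaque
  T : ℕ → ℕ
  T zero    = 0
  T (suc r) = suc r !

  T-zero : T 0 ≡ 0
  T-zero = refl

  T-pos : ∀ r → 1 ≤ T (suc r)
  T-pos r = 1≤n! (suc r)

  T-suc : ∀ r → T (suc (suc r)) ≡ T (suc r) + suc r * T (suc r)
  T-suc r = refl

T-< : ∀ r → T r < T (suc r)
T-< zero    = subst (_< T 1) (sym T-zero) (T-pos 0)
T-< (suc r) = subst (T (suc r) <_) (sym (T-suc r))
  (m<m+n (T (suc r)) (≤-trans (T-pos r) (m≤n*m (T (suc r)) (suc r))))

T-mono-≤ : ∀ {r s} → r ≤ s → T r ≤ T s
T-mono-≤ r≤s = steps (≤⇒≤′ r≤s)
  where
  steps : ∀ {r s} → r ≤′ s → T r ≤ T s
  steps ≤′-refl       = ≤-refl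
  steps (≤′-step {n} r≤n) = ≤-trans (steps r≤n) (<⇒≤ (T-< n))

T-mono-< : ∀ {r s} → r < s → T r < T s
T-mono-< {r} r<s = <-≤-trans (T-< r) (T-mono-≤ r<s)

T-reflect-< : ∀ {r s} → T r < T s → r < s
T-reflect-< Tr<Ts = ≰⇒> λ s≤r → <⇒≱ Tr<Ts (T-mono-≤ s≤r)

T-≥ : ∀ r → r ≤ T r
T-≥ zero    = z≤n
T-≥ (suc r) = ≤-trans (s≤s (T-≥ r)) (T-< r)

T-double : ∀ r → 2 * T (suc r) ≤ T (suc (suc r))
T-double r = begin
  2 * T (suc r)                    ≡⟨ cong (T (suc r) +_) (+-identityʳ _) ⟩
  T (suc r) + T (suc r)            ≤⟨ +-monoʳ-≤ (T (suc r)) (m≤n*m (T (suc r)) (suc r)) ⟩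
  T (suc r) + suc r * T (suc r)    ≡⟨ T-suc r ⟨
  T (suc (suc r))                  ∎
  where open ≤-Reasoning

run-length : ∀ r → T (suc (suc r)) ∸ T (suc r) ≡ suc r * T (suc r)
run-length r = trans (cong (_∸ T (suc r)) (T-suc r)) (m+n∸m≡n (T (suc r)) (suc r * T (suc r)))

run-half : ∀ r → T (suc (suc r)) ≤ 2 * (T (suc (suc r)) ∸ T (suc r))
run-half r = begin
  T (suc (suc r))                         ≡⟨ T-suc r ⟩
  T (suc r) + suc r * T (suc r)           ≤⟨ +-monoˡ-≤ _ (m≤n*m (T (suc r)) (suc r)) ⟩
  suc r * T (suc r) + suc r * T (suc r)   ≡⟨ cong (suc r * T (suc r) +_) (+-identityʳ _) ⟨
  2 * (suc r * T (suc r))                 ≡⟨ cong (2 *_) (run-length r) ⟨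
  2 * (T (suc (suc r)) ∸ T (suc r))       ∎
  where open ≤-Reasoning

run-at : ∀ n → ∃[ r ] T r ≤ n × n < T (suc r)
run-at zero = 0 , ≤-reflexive T-zero , subst (_< T 1) T-zero (T-< 0)
run-at (suc n) with run-at n
... | r , Tr≤n , n<Tr₁ with suc n <? T (suc r)
...   | yes n₁<Tr₁ = r , m≤n⇒m≤1+n Tr≤n , n₁<Tr₁
...   | no  n₁≮Tr₁ = suc r , ≮⇒≥ n₁≮Tr₁ , ≤-<-trans n<Tr₁ (T-< (suc r))

run-≤ : ∀ {r s n} → T r ≤ n → n < T (suc s) → r ≤ s
run-≤ Tr≤n n<Ts₁ = s≤s⁻¹ (T-reflect-< (≤-<-trans Tr≤n n<Ts₁))

run-ending : ∀ n → T 1 < n → ∃[ r ] T (suc r) < n × n ≤ T (suc (suc r))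
run-ending (suc n) (s≤s T₁≤n) with run-at n
... | zero  , _     , n<T₁ = ⊥-elim (<⇒≱ n<T₁ T₁≤n)
... | suc r , Tr≤n , n<Tr₁ = r , s≤s Tr≤n , n<Tr₁

letter : ℕ → Fin 3
letter zero                = zero
letter (suc zero)          = suc zero
letter (suc (suc zero))    = suc (suc zero)
letter (suc (suc (suc r))) = letter r

letter-suc : ∀ r → letter (suc r) ≢ letter r
letter-suc zero                ()
letter-suc (suc zero)          ()
letter-suc (suc (suc zero))    ()
letter-suc (suc (suc (suc r))) = letter-suc r

letter-suc² : ∀ r → letter (suc (suc r)) ≢ letter r
letter-suc² zero                ()
letter-suc² (suc zero)          ()
letter-suc² (suc (suc zero))    ()
letter-suc² (suc (suc (suc r))) = letter-suc² r

runOf : Fin 3 → ℕ → ℕ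
runOf a zero    = toℕ a
runOf a (suc k) = 3 + runOf a k

letter-runOf : ∀ a k → letter (runOf a k) ≡ a
letter-runOf zero                zero    = refl
letter-runOf (suc zero)          zero    = refl
letter-runOf (suc (suc zero))    zero    = refl
letter-runOf a                   (suc k) = letter-runOf a k

runOf-≥ : ∀ a k → k ≤ runOf a k
runOf-≥ a zero    = z≤n
runOf-≥ a (suc k) = s≤s (m≤n⇒m≤1+n (m≤n⇒m≤1+n (runOf-≥ a k)))

w : Word (Fin 3)
w n = letter (proj₁ (run-at n))

w-run : ∀ r {n} → T r ≤ n → n < T (suc r) → w n ≡ letter r
w-run r {n} Tr≤n n<Tr₁ with run-at n
... | s , Ts≤n , n<Ts₁ = cong letter (≤-antisym (run-≤ Ts≤n n<Tr₁) (run-≤ Tr≤n n<Ts₁))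

occ : Fin 3 → ℕ → ℕ → ℕ
occ a = Counting.occ _≟_ w a

occ-run : ∀ r {a} → letter r ≡ a → occ a (T r) (T (suc r)) ≡ T (suc r) ∸ T r
occ-run r refl = Counting.occ-all _≟_ w (letter r) (<⇒≤ (T-< r)) λ k Tr≤k k<Tr₁ → w-run r Tr≤k k<Tr₁

module HalfPrefixes (t : Fin 3) where

  open Counting _≟_ w t using (occ-≤; occ-mono; occ-split; occ-none)

  N : ℕ → ℕ
  N n = occ t 0 n

  -- The i-th t-run used for cutting; it is never run 0, so it has the form suc _.
  run : ℕ → ℕ
  run i = runOf t (suc i)

  cut : ℕ → ℕ
  cut i = 2 * N (T (suc (run i)))

  letter-run : ∀ i → letter (run i) ≡ t
  letter-run i = letter-runOf t (suc i)

  -- Before the cut lies the whole t-run, which is at least half of the prefix ...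
  cut-low : ∀ i → T (suc (run i)) ≤ cut i
  cut-low i = ≤-trans (run-half (suc (suc (runOf t i)))) (*-monoʳ-≤ 2 run-in-prefix)
    where
    j = run i
    run-in-prefix : T (suc j) ∸ T j ≤ N (T (suc j))
    run-in-prefix = ≤-trans (≤-reflexive (sym (occ-run j (letter-run i))))
                            (occ-mono z≤n (<⇒≤ (T-< j)) ≤-refl)

  -- ... and the cut is still inside the next run, which has no t.
  cut-high : ∀ i → cut i ≤ T (suc (suc (run i)))
  cut-high i = ≤-trans (*-monoʳ-≤ 2 (occ-≤ 0 (T (suc (run i))))) (T-double (run i))

  N-flat : ∀ i {z} → T (suc (run i)) ≤ z → z ≤ T (suc (suc (run i))) → N z ≡ N (T (suc (run i)))
  N-flat i {z} start≤z z≤end = begin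
    N z                            ≡⟨ occ-split z≤n start≤z ⟨
    N start + occ t start z        ≡⟨ cong (N start +_) (occ-none start≤z no-t) ⟩
    N start + 0                    ≡⟨ +-identityʳ _ ⟩
    N start                        ∎
    where
    open ≡-Reasoning
    start = T (suc (run i))
    no-t : ∀ k → start ≤ k → k < z → w k ≢ t
    no-t k start≤k k<z wk≡t = letter-suc (run i)
      (trans (sym (w-run (suc (run i)) start≤k (<-≤-trans k<z z≤end))) (trans wk≡t (sym (letter-run i))))

  half-prefix : ∀ i → 2 * N (cut i) ≡ 1 * cut i
  half-prefix i = trans (cong (2 *_) (N-flat i (cut-low i) (cut-high i))) (sym (*-identityˡ (cut i)))

  cut-strict : ∀ i → cut i < cut (suc i)
  cut-strict i = ≤-<-trans (cut-high i) (<-≤-trans later-run (cut-low (suc i)))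
    where
    later-run : T (suc (suc (run i))) < T (suc (run (suc i)))
    later-run = T-mono-< (s≤s (s≤s (s≤s (n≤1+n _))))

third : (b t x y : Fin 3) → t ≢ b → x ≢ b → x ≢ t → y ≢ b → y ≢ t → x ≡ y
third = toWitness {a? = all? λ b → all? λ t → all? λ x → all? λ y →
  ¬? (t ≟ b) →-dec ¬? (x ≟ b) →-dec ¬? (x ≟ t) →-dec ¬? (y ≟ b) →-dec ¬? (y ≟ t) →-dec (x ≟ y)} _

module Merged (a b t : Fin 3) (a≢b : a ≢ b) (t≢a : t ≢ a) (t≢b : t ≢ b) where

  open HalfPrefixes t using (cut; cut-strict; half-prefix)

  u : Word (Without b)
  u = merge a b a≢b w

  a≢t : a ≢ t
  a≢t a≡t = t≢a (sym a≡t)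

  a-letter t-letter : Without b
  a-letter = a , a≢b
  t-letter = t , t≢b

  same-letter : ∀ {x y} (x≢b : x ≢ b) (y≢b : y ≢ b) → x ≡ y → (x , x≢b) ≡ (y , y≢b)
  same-letter _ _ refl = refl

  u-t⇒w-t : ∀ k → u k ≡ t-letter → w k ≡ t
  u-t⇒w-t k u≡t with w k ≟ b
  ... | yes _ = ⊥-elim (a≢t (cong proj₁ u≡t))
  ... | no  _ = cong proj₁ u≡t

  w-t⇒u-t : ∀ k → w k ≡ t → u k ≡ t-letter
  w-t⇒u-t k w≡t with w k ≟ b
  ... | yes w≡b = ⊥-elim (t≢b (trans (sym w≡t) w≡b))
  ... | no  _   rewrite w≡t = refl

  letters : ∀ ℓ → ℓ ≡ a-letter ⊎ ℓ ≡ t-letter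
  letters (x , x≢b) with x ≟ t
  ... | yes refl = inj₂ refl
  ... | no  x≢t  = inj₁ (same-letter x≢b a≢b (third b t x a t≢b x≢b x≢t a≢b a≢t))

  C : Without b → ℕ → ℕ
  C ℓ = blockCount (decWithout b) u cut ℓ

  L : ℕ → ℕ
  L = blockLen cut

  t-half : ∀ i → 2 * C t-letter i ≡ 1 * L i
  t-half i = trans (cong (2 *_) (count-≡ (decWithout b) _≟_ u w t-letter t u-t⇒w-t w-t⇒u-t (cut i) (L i)))
                   (Counting.factor-density _≟_ w t 1 2 (<⇒≤ (cut-strict i)) (half-prefix i) (half-prefix (suc i)))

  a-half : ∀ i → 2 * C a-letter i ≡ 1 * L i
  a-half i = +-cancelʳ-≡ (2 * C t-letter i) (2 * C a-letter i) (1 * L i) (begin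
    2 * C a-letter i + 2 * C t-letter i    ≡⟨ *-distribˡ-+ 2 (C a-letter i) (C t-letter i) ⟨
    2 * (C a-letter i + C t-letter i)      ≡⟨ cong (2 *_) (count-binary (decWithout b) u a-letter t-letter
                                                            (λ a≡t → a≢t (cong proj₁ a≡t)) (λ k → letters (u k)) (cut i) (L i)) ⟩
    2 * L i                                ≡⟨ solve 1 (λ l → (con 2) :* l := (con 1) :* l :+ (con 1) :* l) refl (L i) ⟩
    1 * L i + 1 * L i                      ≡⟨ cong (1 * L i +_) (t-half i) ⟨
    1 * L i + 2 * C t-letter i             ∎)
    where open ≡-Reasoning

  periodic : WeakAbelianPeriodic (decWithout b) u
  periodic = densities⇒periodic (decWithout b) u cut cut-strict (λ _ → 1) 2 half
    where
    half : ∀ ℓ i → 2 * C ℓ i ≡ 1 * L i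
    half ℓ i with letters ℓ
    ... | inj₁ ℓ≡a = subst (λ ℓ → 2 * C ℓ i ≡ 1 * L i) (sym ℓ≡a) (a-half i)
    ... | inj₂ ℓ≡t = subst (λ ℓ → 2 * C ℓ i ≡ 1 * L i) (sym ℓ≡t) (t-half i)

module NotPeriodic (c : ℕ → ℕ) (strict : ∀ i → c i < c (suc i))
  (periodic : ∀ (a : Fin 3) i j → blockCount _≟_ w c a i * blockLen c j ≡ blockCount _≟_ w c a j * blockLen c i)
  where

  open Cuts c strict
  open Counting _≟_ w using (occ-at; occ-none; occ-split; occ-mono; occ-≤)

  C : Fin 3 → ℕ → ℕ
  C a = blockCount _≟_ w c a

  len : ℕ → ℕ
  len = blockLen c

  len-pos : ∀ i → 1 ≤ len i
  len-pos i = m<n⇒0<n∸m (strict i)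

  L₀ : ℕ
  L₀ = len 0

  p : Fin 3 → ℕ
  p a = C a 0

  density : ∀ a i → C a i * L₀ ≡ p a * len i
  density a i = periodic a i 0

  -- Every letter a occurs after the first cut (at the start of a late a-run), so
  -- some block and hence, by the density relation, the first one contains it ...
  p-pos : ∀ a → 1 ≤ p a
  p-pos a = pos-factor (p a) (len i) (sym (density a i)) a-in-block (len-pos 0)
    where
    j = runOf a (c 0)
    found = block-of (T j) (≤-trans (runOf-≥ a (c 0)) (T-≥ j))
    i = proj₁ found
    a-in-block : 1 ≤ C a i
    a-in-block = occ-at a (proj₁ (proj₂ found)) (proj₂ (proj₂ found))
                          (trans (w-run j ≤-refl (T-< j)) (letter-runOf a (c 0)))

  occurs-everywhere : ∀ a i → 1 ≤ C a i
  occurs-everywhere a i = pos-factor (C a i) L₀ (density a i) (p-pos a) (len-pos i)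

  p-≤ : ∀ a → p a ≤ L₀
  p-≤ a = occ-≤ a (c 0) (c 1)

  -- Consider block i = w[c i, c (i+1)) ending inside run r+1.  From T r on it
  -- meets only the runs r and r+1, which carry no letter of run r+2.
  no-late-y : ∀ i r → c (suc i) ≤ T (suc (suc r)) →
    ∀ k → T r ≤ k → k < c (suc i) → w k ≢ letter (suc (suc r))
  no-late-y i r inside-run₁ k Tr≤k k<e with k <? T (suc r)
  ... | yes k<Tr₁ = λ wk≡y → letter-suc² r (trans (sym wk≡y) (w-run r Tr≤k k<Tr₁))
  ... | no  k≮Tr₁ = λ wk≡y → letter-suc (suc r)
          (trans (sym wk≡y) (w-run (suc r) (≮⇒≥ k≮Tr₁) (<-≤-trans k<e inside-run₁)))

  x-many : ∀ i r → c i ≤ T r → T (suc r) ≤ c (suc i) → T (suc r) ∸ T r ≤ C (letter r) i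
  x-many i r s≤Tr run≤e = begin
    T (suc r) ∸ T r              ≡⟨ occ-run r refl ⟨
    occ (letter r) (T r) (T (suc r))
      ≤⟨ occ-mono (letter r) s≤Tr (<⇒≤ (T-< r)) run≤e ⟩
    C (letter r) i               ∎
    where open ≤-Reasoning

  y-few : ∀ i r → c i ≤ T r → T (suc r) < c (suc i) → c (suc i) ≤ T (suc (suc r)) →
    C (letter (suc (suc r))) i ≤ T r
  y-few i r s≤Tr after-run inside-run₁ = begin
    C y i                          ≡⟨ occ-split y s≤Tr Tr≤e ⟨
    occ y s (T r) + occ y (T r) e  ≡⟨ cong (occ y s (T r) +_) (occ-none y Tr≤e (no-late-y i r inside-run₁)) ⟩
    occ y s (T r) + 0              ≡⟨ +-identityʳ _ ⟩
    occ y s (T r)                  ≤⟨ occ-≤ y s (T r) ⟩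
    T r ∸ s                        ≤⟨ m∸n≤m (T r) s ⟩
    T r                            ∎
    where
    open ≤-Reasoning
    s = c i
    e = c (suc i)
    y = letter (suc (suc r))
    Tr≤e : T r ≤ e
    Tr≤e = <⇒≤ (<-trans (T-< r) after-run)

  -- Hence a block ending inside run r+1 bounds r by the length of the first block:
  -- comparing the densities of x = letter r and y = letter (r+2) in it gives
  -- r·T r ≤ C x ≤ C x · p y = C y · p x ≤ T r · L₀.
  bounded-run : ∀ i r → T (suc r) < c (suc i) → c (suc i) ≤ T (suc (suc r)) → r ≤ L₀
  bounded-run i zero       _         _           = z≤n
  bounded-run i r@(suc r₀) after-run inside-run₁ with ≤-total (T r) (c i)
  ... | inj₁ Tr≤s = ⊥-elim (<⇒≱ (occurs-everywhere y i) (≤-reflexive no-y))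
    where
    y = letter (suc (suc r))
    no-y : C y i ≡ 0
    no-y = occ-none y (<⇒≤ (strict i)) λ k s≤k → no-late-y i r inside-run₁ k (≤-trans Tr≤s s≤k)
  ... | inj₂ s≤Tr = *-cancelʳ-≤ r L₀ (T r) {{>-nonZero (T-pos r₀)}} (begin
    r * T r          ≡⟨ run-length r₀ ⟨
    T (suc r) ∸ T r  ≤⟨ x-many i r s≤Tr (<⇒≤ after-run) ⟩
    C x i            ≤⟨ m≤m*n (C x i) (p y) {{>-nonZero (p-pos y)}} ⟩
    C x i * p y      ≡⟨ cross (C x i) (C y i) (p x) (p y) L₀ (len i) {{>-nonZero (len-pos 0)}}
                              (density x i) (density y i) ⟩
    C y i * p x      ≤⟨ *-mono-≤ (y-few i r s≤Tr after-run inside-run₁) (p-≤ x) ⟩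
    T r * L₀         ≡⟨ *-comm (T r) L₀ ⟩
    L₀ * T r         ∎)
    where
    open ≤-Reasoning
    x = letter r
    y = letter (suc (suc r))

  absurd : ⊥
  absurd = <⇒≱ L₀<r (bounded-run i r after-run₁ inside-run₂)
    where
    i = T (suc (suc L₀))
    e = c (suc i)
    far : T (suc (suc L₀)) < e
    far = cut-≥ (suc i)
    ending = run-ending e (≤-<-trans (T-mono-≤ (s≤s z≤n)) far)
    r = proj₁ ending
    after-run₁ = proj₁ (proj₂ ending)
    inside-run₂ = proj₂ (proj₂ ending)
    L₀<r : L₀ < r
    L₀<r = s≤s⁻¹ (s≤s⁻¹ (T-reflect-< (<-≤-trans far inside-run₂)))

not-periodic : ¬ WeakAbelianPeriodic _≟_ w
not-periodic (c , strict , periodic) = NotPeriodic.absurd c strict periodic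

proposition4 : Σ (Word (Fin 3)) λ w →
    WeakAbelianPeriodic (decWithout (suc zero)) (merge zero (suc zero) (λ ()) w)
    × WeakAbelianPeriodic (decWithout (suc (suc zero))) (merge zero (suc (suc zero)) (λ ()) w)
    × WeakAbelianPeriodic (decWithout (suc (suc zero))) (merge (suc zero) (suc (suc zero)) (λ ()) w)
    × ¬ WeakAbelianPeriodic _≟_ w
proposition4 = w
  , Merged.periodic zero (suc zero) (suc (suc zero)) (λ ()) (λ ()) (λ ())
  , Merged.periodic zero (suc (suc zero)) (suc zero) (λ ()) (λ ()) (λ ())
  , Merged.periodic (suc zero) (suc (suc zero)) zero (λ ()) (λ ()) (λ ())
  , not-periodic
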